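{- Let $q,t\in\mathbb N$ and let $M$ be a multigraph (parallel edges allowed, no loops) with $V(M)=[t]$ and maximum degree at most $qt$. Then there is an $M$-linkage $Q=(P_{uv})_{uv\in E(M)}$ in the complete graph $K_t$ on $[t]$ such that every edge $e\in E(K_t)$ appears in at most $18q$ paths of $Q$.
   Context: Degrees in multigraphs count edge multiplicities. A path is a sequence of distinct vertices with consecutive ones adjacent. An $M$-linkage in a graph $H'$ with $V(M)\subseteq V(H')$ is a family $(P_e)_{e\in E(M)}$ of paths in $H'$ where $P_e$ has the two endpoints of $e$ as its endpoints. -}

module Defs where

open import Data.Nat using (ℕ; zero; suc; _+_; _*_; _≤_)
open import Data.Fin using (Fin)
open import Data.Product using (_×_; _,_; proj₁; proj₂; Σ)
open import Data.Sum using (_⊎_)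
open import Data.List using (List; []; _∷_; head; last)
open import Data.List.Relation.Unary.Unique.Propositional using (Unique)
open import Data.List.Relation.Unary.Any using (Any)
open import Data.Maybe using (just)
open import Relation.Binary.PropositionalEquality using (_≡_; _≢_)
open import Relation.Nullary using (Dec; yes; no)
open import Relation.Nullary.Decidable using (⌊_⌋)
open import Data.Bool using (Bool; true; false)

sumFin : (m : ℕ) → (Fin m → ℕ) → ℕ
sumFin zero    f = 0
sumFin (suc m) f = f Fin.zero + sumFin m (λ i → f (Fin.suc i))
  where import Data.Fin as Fin

count : (m : ℕ) {P : Fin m → Set} → ((i : Fin m) → Dec (P i)) → ℕ
count m P? = sumFin m (λ i → if? (P? i))
  where
  if? : ∀ {A : Set} → Dec A → ℕ
  if? (yes _) = 1
  if? (no _)  = 0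

-- A loopless multigraph on vertex set Fin t with m edges (edges indexed by Fin m,
-- parallel edges allowed as repeated pairs).
record Multigraph (t : ℕ) : Set where
  field
    m     : ℕ
    ends  : Fin m → Fin t × Fin t
    loopless : (i : Fin m) → proj₁ (ends i) ≢ proj₂ (ends i)

IsEnd : ∀ {t} → Fin t → Fin t × Fin t → Set
IsEnd v (a , b) = (v ≡ a) ⊎ (v ≡ b)

data UsesEdge {t : ℕ} (a b : Fin t) : List (Fin t) → Set where
  here-ab : ∀ {xs} → UsesEdge a b (a ∷ b ∷ xs)
  here-ba : ∀ {xs} → UsesEdge a b (b ∷ a ∷ xs)
  there   : ∀ {x xs} → UsesEdge a b xs → UsesEdge a b (x ∷ xs)

data ConsecAdjKt {t : ℕ} : List (Fin t) → Set where
  nil  : ConsecAdjKt []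
  one  : ∀ {x} → ConsecAdjKt (x ∷ [])
  cons : ∀ {x y xs} → x ≢ y → ConsecAdjKt (y ∷ xs) → ConsecAdjKt (x ∷ y ∷ xs)

record PathKt {t : ℕ} (u v : Fin t) (P : List (Fin t)) : Set where
  field
    distinct : Unique P
    adjacent : ConsecAdjKt P
    starts   : head P ≡ just u
    ends     : last P ≡ just v

open import Data.Fin.Properties using (_≟_)
open import Data.Sum using (inj₁; inj₂)
open import Relation.Nullary.Decidable using (_×-dec_)
open import Relation.Binary.PropositionalEquality using (refl)

isEnd? : ∀ {t} (v : Fin t) (e : Fin t × Fin t) → Dec (IsEnd v e)
isEnd? v (a , b) with v ≟ a
... | yes p = yes (inj₁ p)
... | no ¬p with v ≟ b
...   | yes r = yes (inj₂ r)
...   | no ¬r = no λ { (inj₁ p) → ¬p p ; (inj₂ r) → ¬r r }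

usesEdge? : ∀ {t} (a b : Fin t) (P : List (Fin t)) → Dec (UsesEdge a b P)
usesEdge? a b [] = no λ ()
usesEdge? a b (x ∷ []) = no λ { (there ()) }
usesEdge? a b (x ∷ y ∷ xs) with (x ≟ a ×-dec y ≟ b) | (x ≟ b ×-dec y ≟ a) | usesEdge? a b (y ∷ xs)
... | yes (refl , refl) | _ | _ = yes here-ab
... | no _ | yes (refl , refl) | _ = yes here-ba
... | no _ | no _ | yes u = yes (there u)
... | no n1 | no n2 | no n3 = no λ
    { here-ab → n1 (refl , refl)
    ; here-ba → n2 (refl , refl)
    ; (there u) → n3 u }

degree : ∀ {t} (M : Multigraph t) → Fin t → ℕ
degree M v = count (Multigraph.m M) (λ i → isEnd? v (Multigraph.ends M i))

load : ∀ {t m} (Q : Fin m → List (Fin t)) → Fin t → Fin t → ℕ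
load {m = m} Q a b = count m (λ i → usesEdge? a b (Q i))

{-# OPTIONS --safe #-}
-- Colour every edge uv of M by a relay vertex w of K_t, greedily, so that each vertex x meets
-- at most 2q edges of any one colour: when uv is coloured, u and v each lie on fewer than qt
-- already coloured edges, so averaging over the t colours gives a w used fewer than 2q times
-- at u and at v together. Route uv as u w v, or directly when w ∈ {u, v}. An edge ab of K_t is
-- then used only by edges at a coloured b and edges at b coloured a, so its load is at most
-- 4q ≤ 18q.
module Submission where

open import Defs
open import Data.Bool using (if_then_else_)
open import Data.Empty using (⊥-elim)
open import Data.Fin using (Fin; zero; suc)
open import Data.Fin.Properties using (_≟_)
open import Data.List using (List; []; _∷_)
open import Data.List.Relation.Unary.All using ([]; _∷_)
open import Data.List.Relation.Unary.AllPairs using ([]; _∷_)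
open import Data.Nat using (ℕ; zero; suc; _+_; _*_; _≤_; _<_; z≤n; s≤s; _<?_)
open import Data.Nat.Properties hiding (_≟_)
open import Algebra.Properties.CommutativeSemigroup +-commutativeSemigroup
  using () renaming (interchange to +-interchange)
open import Data.Product using (Σ; ∃-syntax; _×_; _,_; proj₁; proj₂)
open import Data.Sum using (_⊎_; inj₁; inj₂)
import Data.Vec.Functional as Vector
open import Function using (_∘_)
open import Relation.Nullary using (Dec; yes; no; does)
open import Relation.Nullary.Decidable using (dec-true; _×-dec_; _⊎-dec_)
open import Relation.Binary.PropositionalEquality
  using (_≡_; _≢_; refl; sym; trans; cong; cong₂; subst; module ≡-Reasoning)

private
  variable
    A B : Set
    t m k : ℕ
    a b u v w : Fin t

𝟙 : Dec A → ℕ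
𝟙 a? = if does a? then 1 else 0

𝟙-yes : (a? : Dec A) → A → 𝟙 a? ≡ 1
𝟙-yes a? a = cong (λ β → if β then 1 else 0) (dec-true a? a)

𝟙-mono : (A → B) → (a? : Dec A) (b? : Dec B) → 𝟙 a? ≤ 𝟙 b?
𝟙-mono f (yes a) b? = ≤-reflexive (sym (𝟙-yes b? (f a)))
𝟙-mono f (no _)  b? = z≤n

𝟙-⊎ : (a? : Dec A) (b? : Dec B) → 𝟙 (a? ⊎-dec b?) ≤ 𝟙 a? + 𝟙 b?
𝟙-⊎ (yes _) b? = s≤s z≤n
𝟙-⊎ (no _)  b? = ≤-refl

𝟙-× : (a? : Dec A) (b? : Dec B) → 𝟙 (a? ×-dec b?) ≡ 𝟙 a? * 𝟙 b?
𝟙-× (yes _) b? = sym (+-identityʳ (𝟙 b?))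
𝟙-× (no _)  b? = refl

sumFin-cong : ∀ m {f g : Fin m → ℕ} → (∀ i → f i ≡ g i) → sumFin m f ≡ sumFin m g
sumFin-cong zero    f≡g = refl
sumFin-cong (suc m) f≡g = cong₂ _+_ (f≡g zero) (sumFin-cong m (f≡g ∘ suc))

sumFin-mono : ∀ m {f g : Fin m → ℕ} → (∀ i → f i ≤ g i) → sumFin m f ≤ sumFin m g
sumFin-mono zero    f≤g = z≤n
sumFin-mono (suc m) f≤g = +-mono-≤ (f≤g zero) (sumFin-mono m (f≤g ∘ suc))

sumFin-0 : ∀ m → sumFin m (λ _ → 0) ≡ 0
sumFin-0 zero    = refl
sumFin-0 (suc m) = sumFin-0 m

sumFin-distrib-+ : ∀ m (f g : Fin m → ℕ) → sumFin m (λ i → f i + g i) ≡ sumFin m f + sumFin m g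
sumFin-distrib-+ zero    f g = refl
sumFin-distrib-+ (suc m) f g =
  trans (cong (f zero + g zero +_) (sumFin-distrib-+ m (f ∘ suc) (g ∘ suc)))
        (+-interchange (f zero) (g zero) (sumFin m (f ∘ suc)) (sumFin m (g ∘ suc)))

*-distribˡ-sumFin : ∀ m n (f : Fin m → ℕ) → sumFin m (λ i → n * f i) ≡ n * sumFin m f
*-distribˡ-sumFin zero    n f = sym (*-zeroʳ n)
*-distribˡ-sumFin (suc m) n f =
  trans (cong (n * f zero +_) (*-distribˡ-sumFin m n (f ∘ suc)))
        (sym (*-distribˡ-+ n (f zero) (sumFin m (f ∘ suc))))

-- Since 𝟙 only inspects `does`, 𝟙 (suc j ≟ suc w) reduces to 𝟙 (j ≟ w).
sumFin-≟ : ∀ k (j : Fin k) → sumFin k (λ w → 𝟙 (j ≟ w)) ≡ 1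
sumFin-≟ (suc k) zero    = cong suc (sumFin-0 k)
sumFin-≟ (suc k) (suc j) = sumFin-≟ k j

sumFin-fibres : ∀ k (g : Fin m → ℕ) (c : Fin m → Fin k)
  → sumFin k (λ w → sumFin m (λ i → g i * 𝟙 (c i ≟ w))) ≡ sumFin m g
sumFin-fibres {m = zero}  k g c = sumFin-0 k
sumFin-fibres {m = suc m} k g c = begin
  sumFin k (λ w → g zero * 𝟙 (c zero ≟ w) + rest w)
    ≡⟨ sumFin-distrib-+ k _ rest ⟩
  sumFin k (λ w → g zero * 𝟙 (c zero ≟ w)) + sumFin k rest
    ≡⟨ cong₂ _+_ (*-distribˡ-sumFin k (g zero) _) (sumFin-fibres k (g ∘ suc) (c ∘ suc)) ⟩
  g zero * sumFin k (λ w → 𝟙 (c zero ≟ w)) + sumFin m (g ∘ suc)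
    ≡⟨ cong (λ n → g zero * n + sumFin m (g ∘ suc)) (sumFin-≟ k (c zero)) ⟩
  g zero * 1 + sumFin m (g ∘ suc)
    ≡⟨ cong (_+ sumFin m (g ∘ suc)) (*-identityʳ (g zero)) ⟩
  sumFin (suc m) g ∎
  where
  open ≡-Reasoning
  rest : Fin k → ℕ
  rest w = sumFin m (λ i → g (suc i) * 𝟙 (c (suc i) ≟ w))

sumFin<*⇒∃< : ∀ k n (f : Fin k → ℕ) → sumFin k f < n * k → ∃[ w ] f w < n
sumFin<*⇒∃< zero    n f Σf<n*0 = ⊥-elim (n≮0 (subst (0 <_) (*-zeroʳ n) Σf<n*0))
sumFin<*⇒∃< (suc k) n f Σf<n*k with f zero <? n
... | yes f₀<n = zero , f₀<n
... | no  f₀≮n = let w , fw<n = sumFin<*⇒∃< k n (f ∘ suc) rest< in suc w , fw<n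
  where
  open ≤-Reasoning
  rest< : sumFin k (f ∘ suc) < n * k
  rest< = +-cancelˡ-< n _ _ (begin-strict
    n + sumFin k (f ∘ suc)      ≤⟨ +-monoˡ-≤ _ (≮⇒≥ f₀≮n) ⟩
    f zero + sumFin k (f ∘ suc) <⟨ Σf<n*k ⟩
    n * suc k                   ≡⟨ *-suc n k ⟩
    n + n * k                   ∎)

-- The indicator summed by `count` is local to its where-block and cannot be named;
-- `summands` recovers it from the unfolding of `count`.
summands : ∀ {s} {f : Fin m → ℕ} → s ≡ sumFin m f → Fin m → ℕ
summands {f = f} _ = f

count≡sumFin-𝟙 : ∀ m {P : Fin m → Set} (P? : ∀ i → Dec (P i)) → count m P? ≡ sumFin m (λ i → 𝟙 (P? i))
count≡sumFin-𝟙 m P? = sumFin-cong m summand≡𝟙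
  where
  summand≡𝟙 : ∀ i → summands (refl {x = count m P?}) i ≡ 𝟙 (P? i)
  summand≡𝟙 i with P? i
  ... | yes _ = refl
  ... | no _  = refl

deg : (Fin m → Fin t × Fin t) → Fin t → ℕ
deg {m = m} e x = sumFin m (λ i → 𝟙 (isEnd? x (e i)))

colourDeg : (Fin m → Fin t × Fin t) → (Fin m → Fin k) → Fin t → Fin k → ℕ
colourDeg {m = m} e c x w = sumFin m (λ i → 𝟙 (isEnd? x (e i)) * 𝟙 (c i ≟ w))

sumFin-colourDeg : ∀ k (e : Fin m → Fin t × Fin t) (c : Fin m → Fin k) x
  → sumFin k (colourDeg e c x) ≡ deg e x
sumFin-colourDeg k e c x = sumFin-fibres k (λ i → 𝟙 (isEnd? x (e i))) c

balanced-colouring : ∀ q k (e : Fin m → Fin t × Fin t) → (∀ x → deg e x ≤ q * k)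
  → Σ (Fin m → Fin k) λ c → ∀ x w → colourDeg e c x w ≤ 2 * q
balanced-colouring {m = zero}  q k e deg≤ = (λ ()) , λ _ _ → z≤n
balanced-colouring {m = suc m} {t = t} q k e deg≤ = w₀ Vector.∷ c , colourDeg≤
  where
  e′ : Fin m → Fin t × Fin t
  e′ = e ∘ suc
  u₀ v₀ : Fin t
  u₀ = proj₁ (e zero)
  v₀ = proj₂ (e zero)

  colouring′ : Σ (Fin m → Fin k) λ c → ∀ x w → colourDeg e′ c x w ≤ 2 * q
  colouring′ = balanced-colouring q k e′ (λ x → ≤-trans (m≤n+m _ _) (deg≤ x))
  c : Fin m → Fin k
  c = proj₁ colouring′

  deg′< : ∀ x → IsEnd x (e zero) → deg e′ x < q * k
  deg′< x x∈e₀ = subst (λ n → n + deg e′ x ≤ q * k) (𝟙-yes (isEnd? x (e zero)) x∈e₀) (deg≤ x)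

  used : Fin k → ℕ
  used w = colourDeg e′ c u₀ w + colourDeg e′ c v₀ w

  Σused< : sumFin k used < 2 * q * k
  Σused< = begin-strict
    sumFin k used
      ≡⟨ sumFin-distrib-+ k _ _ ⟩
    sumFin k (colourDeg e′ c u₀) + sumFin k (colourDeg e′ c v₀)
      ≡⟨ cong₂ _+_ (sumFin-colourDeg k e′ c u₀) (sumFin-colourDeg k e′ c v₀) ⟩
    deg e′ u₀ + deg e′ v₀
      <⟨ +-mono-< (deg′< u₀ (inj₁ refl)) (deg′< v₀ (inj₂ refl)) ⟩
    q * k + q * k
      ≡⟨ cong (q * k +_) (+-identityʳ (q * k)) ⟨
    2 * (q * k)
      ≡⟨ *-assoc 2 q k ⟨
    2 * q * k ∎
    where open ≤-Reasoning

  w₀ : Fin k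
  w₀ = proj₁ (sumFin<*⇒∃< k (2 * q) used Σused<)
  used< : used w₀ < 2 * q
  used< = proj₂ (sumFin<*⇒∃< k (2 * q) used Σused<)

  colourDeg≤ : ∀ x w → colourDeg e (w₀ Vector.∷ c) x w ≤ 2 * q
  colourDeg≤ x w with isEnd? x (e zero) | w₀ ≟ w
  ... | yes (inj₁ refl) | yes refl = ≤-<-trans (m≤m+n _ _) used<
  ... | yes (inj₂ refl) | yes refl = ≤-<-trans (m≤n+m _ (colourDeg e′ c u₀ w₀)) used<
  ... | yes _           | no _     = proj₂ colouring′ x w
  ... | no _            | _        = proj₂ colouring′ x w

route : Fin t → Fin t → Fin t → List (Fin t)
route u v w with isEnd? w (u , v)
... | yes _ = u ∷ v ∷ []
... | no _  = u ∷ w ∷ v ∷ []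

route-path : u ≢ v → PathKt u v (route u v w)
route-path {u = u} {v} {w} u≢v with isEnd? w (u , v)
... | yes _    = record
  { distinct = (u≢v ∷ []) ∷ [] ∷ []
  ; adjacent = cons u≢v one
  ; starts   = refl
  ; ends     = refl
  }
... | no w∉uv = record
  { distinct = (u≢w ∷ u≢v ∷ []) ∷ (w≢v ∷ []) ∷ [] ∷ []
  ; adjacent = cons u≢w (cons w≢v one)
  ; starts   = refl
  ; ends     = refl
  }
  where
  u≢w : u ≢ w
  u≢w = w∉uv ∘ inj₁ ∘ sym
  w≢v : w ≢ v
  w≢v = w∉uv ∘ inj₂

JoinsEndToRelay : Fin t → Fin t → Fin t × Fin t → Fin t → Set
JoinsEndToRelay a b e w = (IsEnd a e × w ≡ b) ⊎ (IsEnd b e × w ≡ a)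

direct-uses : IsEnd w (u , v) → UsesEdge a b (u ∷ v ∷ []) → JoinsEndToRelay a b (u , v) w
direct-uses (inj₁ refl) here-ab = inj₂ (inj₂ refl , refl)
direct-uses (inj₂ refl) here-ab = inj₁ (inj₁ refl , refl)
direct-uses (inj₁ refl) here-ba = inj₁ (inj₂ refl , refl)
direct-uses (inj₂ refl) here-ba = inj₂ (inj₁ refl , refl)
direct-uses _ (there (there ()))

relayed-uses : UsesEdge a b (u ∷ w ∷ v ∷ []) → JoinsEndToRelay a b (u , v) w
relayed-uses here-ab                 = inj₁ (inj₁ refl , refl)
relayed-uses here-ba                 = inj₂ (inj₁ refl , refl)
relayed-uses (there here-ab)         = inj₂ (inj₂ refl , refl)
relayed-uses (there here-ba)         = inj₁ (inj₂ refl , refl)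
relayed-uses (there (there (there ())))

route-uses : UsesEdge a b (route u v w) → JoinsEndToRelay a b (u , v) w
route-uses {u = u} {v} {w} uses with isEnd? w (u , v)
... | yes w∈uv = direct-uses w∈uv uses
... | no _     = relayed-uses uses

relayLinkage : (Fin m → Fin t × Fin t) → (Fin m → Fin t) → Fin m → List (Fin t)
relayLinkage e c i = route (proj₁ (e i)) (proj₂ (e i)) (c i)

load-relayLinkage : ∀ (e : Fin m → Fin t × Fin t) c a b
  → load (relayLinkage e c) a b ≤ colourDeg e c a b + colourDeg e c b a
load-relayLinkage {m = m} e c a b = begin
  load (relayLinkage e c) a b
    ≡⟨ count≡sumFin-𝟙 m (λ i → usesEdge? a b (relayLinkage e c i)) ⟩
  sumFin m (λ i → 𝟙 (usesEdge? a b (relayLinkage e c i)))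
    ≤⟨ sumFin-mono m uses≤ ⟩
  sumFin m (λ i → 𝟙 (isEnd? a (e i)) * 𝟙 (c i ≟ b) + 𝟙 (isEnd? b (e i)) * 𝟙 (c i ≟ a))
    ≡⟨ sumFin-distrib-+ m _ _ ⟩
  colourDeg e c a b + colourDeg e c b a ∎
  where
  open ≤-Reasoning
  uses≤ : ∀ i → 𝟙 (usesEdge? a b (relayLinkage e c i))
               ≤ 𝟙 (isEnd? a (e i)) * 𝟙 (c i ≟ b) + 𝟙 (isEnd? b (e i)) * 𝟙 (c i ≟ a)
  uses≤ i = begin
    𝟙 (usesEdge? a b (relayLinkage e c i))
      ≤⟨ 𝟙-mono route-uses (usesEdge? a b (relayLinkage e c i)) (a∈e×c≟b ⊎-dec b∈e×c≟a) ⟩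
    𝟙 (a∈e×c≟b ⊎-dec b∈e×c≟a)
      ≤⟨ 𝟙-⊎ a∈e×c≟b b∈e×c≟a ⟩
    𝟙 a∈e×c≟b + 𝟙 b∈e×c≟a
      ≡⟨ cong₂ _+_ (𝟙-× (isEnd? a (e i)) (c i ≟ b)) (𝟙-× (isEnd? b (e i)) (c i ≟ a)) ⟩
    𝟙 (isEnd? a (e i)) * 𝟙 (c i ≟ b) + 𝟙 (isEnd? b (e i)) * 𝟙 (c i ≟ a) ∎
    where
    a∈e×c≟b : Dec (IsEnd a (e i) × c i ≡ b)
    a∈e×c≟b = isEnd? a (e i) ×-dec c i ≟ b
    b∈e×c≟a : Dec (IsEnd b (e i) × c i ≡ a)
    b∈e×c≟a = isEnd? b (e i) ×-dec c i ≟ a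

lemma35 : (q t : ℕ) (M : Multigraph t)
    → (∀ (v : Fin t) → degree M v ≤ q * t)
    → Σ (Fin (Multigraph.m M) → List (Fin t)) λ Q
        → ((i : Fin (Multigraph.m M)) → PathKt (proj₁ (Multigraph.ends M i)) (proj₂ (Multigraph.ends M i)) (Q i))
        × ((a b : Fin t) → a ≢ b → load Q a b ≤ 18 * q)
lemma35 q t M degree≤ = relayLinkage ends c , paths , load≤
  where
  open Multigraph M renaming (m to edgeCount)
  colouring : Σ (Fin edgeCount → Fin t) λ c → ∀ x w → colourDeg ends c x w ≤ 2 * q
  colouring = balanced-colouring q t ends λ x →
    subst (_≤ q * t) (count≡sumFin-𝟙 edgeCount (λ i → isEnd? x (ends i))) (degree≤ x)
  c : Fin edgeCount → Fin t
  c = proj₁ colouring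
  paths : ∀ i → PathKt (proj₁ (ends i)) (proj₂ (ends i)) (relayLinkage ends c i)
  paths i = route-path (loopless i)
  load≤ : ∀ a b → a ≢ b → load (relayLinkage ends c) a b ≤ 18 * q
  load≤ a b _ = begin
    load (relayLinkage ends c) a b
      ≤⟨ load-relayLinkage ends c a b ⟩
    colourDeg ends c a b + colourDeg ends c b a
      ≤⟨ +-mono-≤ (proj₂ colouring a b) (proj₂ colouring b a) ⟩
    2 * q + 2 * q
      ≡⟨ *-distribʳ-+ q 2 2 ⟨
    4 * q
      ≤⟨ *-monoˡ-≤ q (m≤m+n 4 14) ⟩
    18 * q ∎
    where open ≤-Reasoning
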